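{- Let $G$ be a graph on $N \geq 12$ vertices. Then there is an induced subgraph $G'$ of $G$ with $|V(G')| \geq N/6$ and $\Delta(G') \leq d(G') \cdot \log |V(G')|$.
   Context: $\Delta(G')$ denotes the maximum degree and $d(G')$ the average degree of $G'$; $\log$ denotes the natural logarithm. -}

module Defs where

open import Data.Nat using (ℕ; zero; suc; _+_; _*_; _^_; _≤_; _<ᵇ_; _⊔_)
open import Data.Bool using (Bool; true; false; _∧_; if_then_else_)
open import Data.Fin using (Fin; toℕ)
open import Data.List using (List; map; foldr; allFin)
open import Data.Nat.ListAction using (sum)
open import Data.Vec using (lookup)
open import Data.Fin.Subset using (Subset; ∣_∣)
open import Relation.Binary.PropositionalEquality using (_≡_)

record Graph (N : ℕ) : Set where
  field
    adj    : Fin N → Fin N → Bool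
    sym    : ∀ u v → adj u v ≡ adj v u
    irrefl : ∀ v → adj v v ≡ false
open Graph public

module _ {N : ℕ} (G : Graph N) (S : Subset N) where
  inS : Fin N → Bool
  inS v = lookup S v

  degIn : Fin N → ℕ
  degIn v = sum (map (λ u → if inS u ∧ adj G v u then 1 else 0) (allFin N))

  edgesIn : ℕ
  edgesIn = sum (map (λ u → sum (map (λ v →
              if (toℕ u <ᵇ toℕ v) ∧ inS u ∧ inS v ∧ adj G u v then 1 else 0)
              (allFin N))) (allFin N))

  -- maximum degree Δ(G[S]) (0 for the empty graph)
  maxDegIn : ℕ
  maxDegIn = foldr _⊔_ 0 (map (λ v → if inS v then degIn v else 0) (allFin N))

-- expScaled a K = K! * Σ_{k=0}^{K} a^k / k!   (a natural number)
expScaled : ℕ → ℕ → ℕ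
expScaled a zero    = 1
expScaled a (suc K) = suc K * expScaled a K + a ^ suc K

-- ExpLe a M  means  e^a ≤ M  (real exponential), expressed via the
-- increasing partial sums of the exponential series: e^a ≤ M iff every
-- partial sum Σ_{k≤K} a^k/k! is ≤ M, i.e. K! * (partial sum) ≤ M * K!.
factorial : ℕ → ℕ
factorial zero    = 1
factorial (suc n) = suc n * factorial n

ExpLe : ℕ → ℕ → Set
ExpLe a M = ∀ K → expScaled a K ≤ M * factorial K

-- While the current vertex set, of size n, has maximum degree Δ with Δ·n > 2κ(n)·|E|, where
-- 3 ^ κ(n) ≤ n, delete a vertex of maximum degree. Once the test fails,
-- e ^ (Δn) ≤ 3 ^ (Δn) ≤ n ^ (2|E|) because e ≤ 3. A deletion at size n multiplies |E| by less
-- than 1 - 2κ(n)/n, so it suffices that (N²/2) ∏_{m < n ≤ N} (1 - 2κ(n)/n) < 1 for m = ⌈N/6⌉: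
-- if the deletion goes all the way down to m vertices, no edge is left. For N < 480 this is
-- checked by evaluation with κ(n) = ⌊log₃ n⌋ capped at 4; for larger N the constant
-- κ = ⌊log₃ (m + 1)⌋ makes the product telescope into a quotient of falling factorials, at most
-- (m/N) ^ (2κ).

module Submission where

open import Defs
open import Data.Nat using (ℕ; _*_; _^_; _≤_)
open import Data.Fin.Subset using (Subset; ∣_∣)
open import Data.Product using (Σ; _×_)

open import Data.Nat
  using (zero; suc; _+_; _∸_; _<_; _<ᵇ_; _<?_; _≤?_; z≤n; s≤s; s≤s⁻¹; >-nonZero)
open import Data.Nat.Properties
open import Data.Nat.DivMod using (_/_; _%_; m≡m%n+[m/n]*n; m%n<n; m/n*n≤m)
open import Data.Nat.Combinatorics.Base using (_P′_)
import Data.Nat.ListAction as List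
open import Data.Nat.Tactic.RingSolver using (solve-∀)
open import Algebra.Properties.CommutativeSemigroup *-commutativeSemigroup
  using (interchange; x∙yz≈y∙xz; x∙yz≈xz∙y; xy∙z≈y∙xz; xy∙z≈xz∙y; xy∙z≈x∙zy; xy∙z≈y∙zx)
open import Algebra.Properties.CommutativeMonoid.Sum +-0-commutativeMonoid
  using (sum; sum-syntax; ∑-distrib-+; ∑-comm; sum-cong-≗)
open import Data.Bool using (Bool; true; false; _∧_; if_then_else_)
open import Data.Bool.Properties using (∧-zeroʳ)
open import Data.Empty using (⊥-elim)
open import Data.Fin using (Fin; zero; suc; toℕ; fromℕ<)
import Data.Fin.Properties as Fin
open import Data.Fin.Subset using (⊤)
open import Data.Fin.Subset.Properties using (∣⊤∣≡n)
open import Data.List using (map; allFin; tabulate)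
open import Data.List.Properties using (map-tabulate)
open import Data.List.Membership.Propositional.Properties using (foldr-selective; ∈-map⁻)
open import Data.Product using (∃-syntax; _,_)
open import Data.Sum using (_⊎_; inj₁; inj₂)
open import Data.Unit using (tt)
open import Data.Vec using (_∷_; lookup; _[_]≔_)
open import Data.Vec.Properties using (lookup∘update; lookup∘update′)
open import Function using (id; _∘_)
open import Relation.Binary using (tri<; tri≈; tri>)
open import Relation.Binary.PropositionalEquality as ≡
  using (_≡_; refl; cong; cong₂; subst; trans; module ≡-Reasoning)
open import Relation.Nullary using (does; yes; no; ofⁿ)
open import Relation.Nullary.Decidable using (toWitness)

-- The exponential bound e ^ a ≤ 3 ^ a

^-distribʳ-* : ∀ m n k → (m * n) ^ k ≡ m ^ k * n ^ k
^-distribʳ-* m n zero    = refl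
^-distribʳ-* m n (suc k) = begin
  m * n * (m * n) ^ k     ≡⟨ cong (m * n *_) (^-distribʳ-* m n k) ⟩
  m * n * (m ^ k * n ^ k) ≡⟨ interchange m n (m ^ k) (n ^ k) ⟩
  m * m ^ k * (n * n ^ k) ∎
  where open ≡-Reasoning

rising : ℕ → ℕ → ℕ
rising M zero    = 1
rising M (suc k) = rising M k * (M + k)

^≤rising : ∀ M k → M ^ k ≤ rising M k
^≤rising M zero    = ≤-refl
^≤rising M (suc k) = begin
  M * M ^ k            ≡⟨ *-comm M (M ^ k) ⟩
  M ^ k * M            ≤⟨ *-mono-≤ (^≤rising M k) (m≤m+n M k) ⟩
  rising M k * (M + k) ∎
  where open ≤-Reasoning

rising-suc : ∀ M k → rising M (suc k) ≡ M * rising (suc M) k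
rising-suc M zero    = trans (*-identityˡ (M + 0)) (trans (+-identityʳ M) (≡.sym (*-identityʳ M)))
rising-suc M (suc k) = begin
  rising M (suc k) * (M + suc k)     ≡⟨ cong₂ _*_ (rising-suc M k) (+-suc M k) ⟩
  M * rising (suc M) k * (suc M + k) ≡⟨ *-assoc M _ _ ⟩
  M * rising (suc M) (suc k)         ∎
  where open ≡-Reasoning

rising-zero : ∀ k → rising 0 (suc k) ≡ 0
rising-zero k = rising-suc 0 k

rising-pascal : ∀ M k → rising (suc M) (suc k) ≡ rising M (suc k) + suc k * rising (suc M) k
rising-pascal M k rewrite rising-suc M k = identity M k (rising (suc M) k)
  where
  identity : ∀ M k r → r * suc (M + k) ≡ M * r + suc k * r
  identity = solve-∀

-- q ^ K * K ! * ∑_{k ≤ K} rising M k / (q ^ k * k !), a scaled partial sum of the binomial series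
-- (1 - 1/q) ^ (- M) = ∑_k rising M k / (q ^ k * k !).
negBinomial : ℕ → ℕ → ℕ → ℕ
negBinomial q M zero    = 1
negBinomial q M (suc K) = q * suc K * negBinomial q M K + rising M (suc K)

negBinomial-pascal : ∀ p M K →
  suc p * negBinomial (suc p) M K ≡ p * negBinomial (suc p) (suc M) K + rising (suc M) K
negBinomial-pascal p M zero    =
  trans (*-identityʳ (suc p)) (trans (+-comm 1 p) (cong (_+ 1) (≡.sym (*-identityʳ p))))
negBinomial-pascal p M (suc K) rewrite rising-pascal M K =
  step (suc K) (negBinomial (suc p) M K) (negBinomial (suc p) (suc M) K)
       (rising (suc M) K) (rising M (suc K)) (negBinomial-pascal p M K)
  where
  step : ∀ s b b′ d a → suc p * b ≡ p * b′ + d →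
         suc p * (suc p * s * b + a) ≡ p * (suc p * s * b′ + (a + s * d)) + (a + s * d)
  step s b b′ d a eq = begin
    suc p * (suc p * s * b + a)          ≡⟨ expand p s b a ⟩
    suc p * s * (suc p * b) + suc p * a  ≡⟨ cong (λ x → suc p * s * x + suc p * a) eq ⟩
    suc p * s * (p * b′ + d) + suc p * a ≡⟨ collect p s b′ d a ⟩
    p * (suc p * s * b′ + (a + s * d)) + (a + s * d) ∎
    where
    open ≡-Reasoning
    expand : ∀ p s b a → suc p * (suc p * s * b + a) ≡ suc p * s * (suc p * b) + suc p * a
    expand = solve-∀
    collect : ∀ p s b′ d a →
              suc p * s * (p * b′ + d) + suc p * a ≡ p * (suc p * s * b′ + (a + s * d)) + (a + s * d)
    collect = solve-∀

negBinomial-suc≤ : ∀ p M K → p * negBinomial (suc p) (suc M) K ≤ suc p * negBinomial (suc p) M K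
negBinomial-suc≤ p M K rewrite negBinomial-pascal p M K = m≤m+n _ _

negBinomial-bound : ∀ p M K → p ^ M * negBinomial (suc p) M K ≤ suc p ^ M * negBinomial (suc p) 0 K
negBinomial-bound p zero    K = ≤-refl
negBinomial-bound p (suc M) K = begin
  p * p ^ M * B (suc M)          ≡⟨ xy∙z≈y∙xz p (p ^ M) (B (suc M)) ⟩
  p ^ M * (p * B (suc M))        ≤⟨ *-monoʳ-≤ (p ^ M) (negBinomial-suc≤ p M K) ⟩
  p ^ M * (suc p * B M)          ≡⟨ x∙yz≈y∙xz (p ^ M) (suc p) (B M) ⟩
  suc p * (p ^ M * B M)          ≤⟨ *-monoʳ-≤ (suc p) (negBinomial-bound p M K) ⟩
  suc p * (suc p ^ M * B 0)      ≡⟨ *-assoc (suc p) (suc p ^ M) (B 0) ⟨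
  suc p * suc p ^ M * B 0        ∎
  where
  open ≤-Reasoning
  B : ℕ → ℕ
  B M = negBinomial (suc p) M K

negBinomial-zero : ∀ q K → negBinomial q 0 K ≡ q ^ K * factorial K
negBinomial-zero q zero    = refl
negBinomial-zero q (suc K) rewrite rising-zero K | negBinomial-zero q K =
  identity q K (q ^ K) (factorial K)
  where
  identity : ∀ q K x y → q * suc K * (x * y) + 0 ≡ q * x * (suc K * y)
  identity = solve-∀

expScaled≤negBinomial : ∀ q a K → expScaled a K * q ^ K ≤ negBinomial q (q * a) K
expScaled≤negBinomial q a zero    = ≤-refl
expScaled≤negBinomial q a (suc K) = begin
  (suc K * E + a ^ suc K) * (q * q ^ K)
    ≡⟨ identity (suc K) E (a ^ suc K) (q ^ K) q ⟩
  q * suc K * (E * q ^ K) + q ^ suc K * a ^ suc K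
    ≡⟨ cong (q * suc K * (E * q ^ K) +_) (^-distribʳ-* q a (suc K)) ⟨
  q * suc K * (E * q ^ K) + (q * a) ^ suc K
    ≤⟨ +-mono-≤ (*-monoʳ-≤ (q * suc K) (expScaled≤negBinomial q a K)) (^≤rising (q * a) (suc K)) ⟩
  q * suc K * negBinomial q (q * a) K + rising (q * a) (suc K)
    ∎
  where
  open ≤-Reasoning
  E = expScaled a K
  identity : ∀ s e t x q → (s * e + t) * (q * x) ≡ q * s * (e * x) + q * x * t
  identity = solve-∀

-- e ^ a ≤ (1 + 1/p) ^ ((1 + p) a), from e ^ x ≤ (1 - x/M) ^ (- M) at x = a, M = (1 + p) a.
expScaled-bound : ∀ p a K → expScaled a K * p ^ (suc p * a) ≤ suc p ^ (suc p * a) * factorial K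
expScaled-bound p a K = *-cancelʳ-≤ _ _ (suc p ^ K) {{m^n≢0 (suc p) K}} (begin
  expScaled a K * p ^ M * suc p ^ K        ≡⟨ xy∙z≈y∙xz (expScaled a K) (p ^ M) (suc p ^ K) ⟩
  p ^ M * (expScaled a K * suc p ^ K)      ≤⟨ *-monoʳ-≤ (p ^ M) (expScaled≤negBinomial (suc p) a K) ⟩
  p ^ M * negBinomial (suc p) M K          ≤⟨ negBinomial-bound p M K ⟩
  suc p ^ M * negBinomial (suc p) 0 K      ≡⟨ cong (suc p ^ M *_) (negBinomial-zero (suc p) K) ⟩
  suc p ^ M * (suc p ^ K * factorial K)    ≡⟨ x∙yz≈xz∙y (suc p ^ M) (suc p ^ K) (factorial K) ⟩
  suc p ^ M * factorial K * suc p ^ K      ∎)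
  where
  open ≤-Reasoning
  M = suc p * a

ExpLe-3^ : ∀ a → ExpLe a (3 ^ a)
ExpLe-3^ a K = *-cancelʳ-≤ _ _ (5 ^ (6 * a)) {{m^n≢0 5 (6 * a)}} (begin
  expScaled a K * 5 ^ (6 * a)       ≤⟨ expScaled-bound 5 a K ⟩
  6 ^ (6 * a) * factorial K         ≤⟨ *-monoˡ-≤ (factorial K) 6⁶ᵃ≤3ᵃ5⁶ᵃ ⟩
  3 ^ a * 5 ^ (6 * a) * factorial K ≡⟨ xy∙z≈xz∙y (3 ^ a) (5 ^ (6 * a)) (factorial K) ⟩
  3 ^ a * factorial K * 5 ^ (6 * a) ∎)
  where
  open ≤-Reasoning
  6⁶ᵃ≤3ᵃ5⁶ᵃ : 6 ^ (6 * a) ≤ 3 ^ a * 5 ^ (6 * a)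
  6⁶ᵃ≤3ᵃ5⁶ᵃ = begin
    6 ^ (6 * a)         ≡⟨ ^-*-assoc 6 6 a ⟨
    (6 ^ 6) ^ a         ≤⟨ ^-monoˡ-≤ a (m≤m+n (6 ^ 6) 219) ⟩
    (3 * 5 ^ 6) ^ a     ≡⟨ ^-distribʳ-* 3 (5 ^ 6) a ⟩
    3 ^ a * (5 ^ 6) ^ a ≡⟨ cong (3 ^ a *_) (^-*-assoc 5 6 a) ⟩
    3 ^ a * 5 ^ (6 * a) ∎

ExpLe-mono : ∀ {a M M′} → M ≤ M′ → ExpLe a M → ExpLe a M′
ExpLe-mono M≤M′ e^a≤M K = ≤-trans (e^a≤M K) (*-monoˡ-≤ (factorial K) M≤M′)

ExpLe-^ : ∀ {a k n e} → 3 ^ k ≤ n → a ≤ k * e → ExpLe a (n ^ e)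
ExpLe-^ {a} {k} {n} {e} 3ᵏ≤n a≤ke = ExpLe-mono (begin
  3 ^ a       ≤⟨ ^-monoʳ-≤ 3 a≤ke ⟩
  3 ^ (k * e) ≡⟨ ^-*-assoc 3 k e ⟨
  (3 ^ k) ^ e ≤⟨ ^-monoˡ-≤ e 3ᵏ≤n ⟩
  n ^ e       ∎) (ExpLe-3^ a)
  where open ≤-Reasoning

sum-map-allFin : ∀ {n} (f : Fin n → ℕ) → List.sum (map f (allFin n)) ≡ ∑[ i < n ] f i
sum-map-allFin f = trans (cong List.sum (map-tabulate id f)) (sum-tabulate f)
  where
  sum-tabulate : ∀ {n} (f : Fin n → ℕ) → List.sum (tabulate f) ≡ sum f
  sum-tabulate {zero}  f = refl
  sum-tabulate {suc n} f = cong (f zero +_) (sum-tabulate (f ∘ suc))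

∑-const : ∀ n c → ∑[ i < n ] c ≡ n * c
∑-const zero    c = refl
∑-const (suc n) c = cong (c +_) (∑-const n c)

∑-mono-≤ : ∀ {n} {f g : Fin n → ℕ} → (∀ i → f i ≤ g i) → ∑[ i < n ] f i ≤ ∑[ i < n ] g i
∑-mono-≤ {zero}  f≤g = z≤n
∑-mono-≤ {suc n} f≤g = +-mono-≤ (f≤g zero) (∑-mono-≤ (f≤g ∘ suc))

onlyAt : ∀ {n} → Fin n → Fin n → ℕ → ℕ
onlyAt v x t = if does (x Fin.≟ v) then t else 0

∑-onlyAt : ∀ {n} (f : Fin n → ℕ) v → ∑[ x < n ] onlyAt v x (f x) ≡ f v
∑-onlyAt {suc n} f zero    = trans (cong (f zero +_) (trans (∑-const n 0) (*-zeroʳ n))) (+-identityʳ (f zero))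
∑-onlyAt {suc n} f (suc v) = ∑-onlyAt (f ∘ suc) v

∑∑ : ∀ {n} → (Fin n → Fin n → ℕ) → ℕ
∑∑ {n} f = ∑[ u < n ] ∑[ w < n ] f u w

∑∑-distrib-+ : ∀ {n} (f g : Fin n → Fin n → ℕ) → ∑∑ (λ u w → f u w + g u w) ≡ ∑∑ f + ∑∑ g
∑∑-distrib-+ {n} f g = trans (sum-cong-≗ (λ u → ∑-distrib-+ (f u) (g u)))
                              (∑-distrib-+ (λ u → ∑[ w < n ] f u w) (λ u → ∑[ w < n ] g u w))

𝟙 : Bool → ℕ
𝟙 b = if b then 1 else 0

𝟙≤1 : ∀ b → 𝟙 b ≤ 1
𝟙≤1 false = z≤n
𝟙≤1 true  = ≤-refl

<ᵇ-true : ∀ {m n} → m < n → (m <ᵇ n) ≡ true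
<ᵇ-true {zero}  {suc n} _         = refl
<ᵇ-true {suc m} {suc n} (s≤s m<n) = <ᵇ-true m<n

<ᵇ-false : ∀ {m n} → n ≤ m → (m <ᵇ n) ≡ false
<ᵇ-false {m}     {zero}  _         = refl
<ᵇ-false {suc m} {suc n} (s≤s n≤m) = <ᵇ-false n≤m

∣p[x]≔false∣ : ∀ {n} (p : Subset n) x → lookup p x ≡ true → suc ∣ p [ x ]≔ false ∣ ≡ ∣ p ∣
∣p[x]≔false∣ (true  ∷ p) zero    refl = refl
∣p[x]≔false∣ (false ∷ p) (suc x) x∈p  = ∣p[x]≔false∣ p x x∈p
∣p[x]≔false∣ (true  ∷ p) (suc x) x∈p  = cong suc (∣p[x]≔false∣ p x x∈p)

-- Removing a vertex

n*e′≤e*[n∸2k] : ∀ {n e e′ d k} → e′ + d ≡ e → k * (2 * e) < d * n → n * e′ ≤ e * (n ∸ 2 * k)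
n*e′≤e*[n∸2k] {n} {e} {e′} {d} {k} e′+d≡e 2ke<dn = begin
  n * e′                ≤⟨ m+n≤o⇒m≤o∸n (n * e′) n*e′+e*2k≤e*n ⟩
  e * n ∸ e * (2 * k)   ≡⟨ *-distribˡ-∸ e n (2 * k) ⟨
  e * (n ∸ 2 * k)       ∎
  where
  open ≤-Reasoning
  swap : ∀ e k → e * (2 * k) ≡ k * (2 * e)
  swap = solve-∀
  collect : ∀ n e′ d → n * e′ + d * n ≡ (e′ + d) * n
  collect = solve-∀
  n*e′+e*2k≤e*n : n * e′ + e * (2 * k) ≤ e * n
  n*e′+e*2k≤e*n = begin
    n * e′ + e * (2 * k) ≡⟨ cong (n * e′ +_) (swap e k) ⟩
    n * e′ + k * (2 * e) ≤⟨ +-monoʳ-≤ (n * e′) (<⇒≤ 2ke<dn) ⟩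
    n * e′ + d * n       ≡⟨ collect n e′ d ⟩
    (e′ + d) * n         ≡⟨ cong (_* n) e′+d≡e ⟩
    e * n                ∎

module _ {N : ℕ} (G : Graph N) where

  edge : Subset N → Fin N → Fin N → ℕ
  edge S u w = 𝟙 ((toℕ u <ᵇ toℕ w) ∧ inS G S u ∧ inS G S w ∧ adj G u w)

  edgesIn-∑ : ∀ S → edgesIn G S ≡ ∑[ u < N ] ∑[ w < N ] edge S u w
  edgesIn-∑ S = trans (sum-map-allFin (λ u → List.sum (map (edge S u) (allFin N))))
                      (sum-cong-≗ (λ u → sum-map-allFin (edge S u)))

  degIn-∑ : ∀ S v → degIn G S v ≡ ∑[ u < N ] 𝟙 (inS G S u ∧ adj G v u)
  degIn-∑ S v = sum-map-allFin (λ u → 𝟙 (inS G S u ∧ adj G v u))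

  edge-+-flip : ∀ S u w → edge S u w + edge S w u ≡ 𝟙 (inS G S u ∧ inS G S w ∧ adj G u w)
  edge-+-flip S u w with Fin.<-cmp u w
  ... | tri< u<w _ _ rewrite <ᵇ-true u<w | <ᵇ-false {toℕ w} (<⇒≤ u<w) = +-identityʳ _
  ... | tri≈ _ refl _ rewrite <ᵇ-false {toℕ u} ≤-refl | irrefl G u
                              | ∧-zeroʳ (inS G S u) | ∧-zeroʳ (inS G S u) = refl
  ... | tri> _ _ w<u rewrite <ᵇ-false {toℕ u} (<⇒≤ w<u) | <ᵇ-true w<u | Graph.sym G w u
    with inS G S u | inS G S w
  ...   | false | false = refl
  ...   | false | true  = refl
  ...   | true  | false = refl
  ...   | true  | true  = refl

  edge-split : ∀ S v u w →
    edge S u w ≡ edge (S [ v ]≔ false) u w + (onlyAt v w (edge S u w) + onlyAt v u (edge S u w))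
  edge-split S v u w with u Fin.≟ v | w Fin.≟ v
  ... | yes refl | yes refl rewrite <ᵇ-false {toℕ u} ≤-refl = refl
  ... | yes refl | no w≢v rewrite lookup∘update u S false | ∧-zeroʳ (toℕ u <ᵇ toℕ w) = refl
  ... | no u≢v | yes refl rewrite lookup∘update w S false | lookup∘update′ u≢v S false
                                | ∧-zeroʳ (inS G S u) | ∧-zeroʳ (toℕ u <ᵇ toℕ w)
    = ≡.sym (+-identityʳ _)
  ... | no u≢v | no w≢v rewrite lookup∘update′ u≢v S false | lookup∘update′ w≢v S false
    = ≡.sym (+-identityʳ _)

  ∑∑-edge-remove : ∀ S v →
    ∑∑ (edge S) ≡ ∑∑ (edge (S [ v ]≔ false)) + (∑[ u < N ] edge S u v + ∑[ w < N ] edge S v w)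
  ∑∑-edge-remove S v = begin
    ∑∑ (edge S)
      ≡⟨ sum-cong-≗ (λ u → sum-cong-≗ (edge-split S v u)) ⟩
    ∑∑ (λ u w → edge S′ u w + (at-column u w + at-row u w))
      ≡⟨ ∑∑-distrib-+ (edge S′) (λ u w → at-column u w + at-row u w) ⟩
    ∑∑ (edge S′) + ∑∑ (λ u w → at-column u w + at-row u w)
      ≡⟨ cong (∑∑ (edge S′) +_) (∑∑-distrib-+ at-column at-row) ⟩
    ∑∑ (edge S′) + (∑∑ at-column + ∑∑ at-row)
      ≡⟨ cong (∑∑ (edge S′) +_) (cong₂ _+_ column row) ⟩
    ∑∑ (edge S′) + (∑[ u < N ] edge S u v + ∑[ w < N ] edge S v w) ∎
    where
    open ≡-Reasoning
    S′ = S [ v ]≔ false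
    at-column at-row : Fin N → Fin N → ℕ
    at-column u w = onlyAt v w (edge S u w)
    at-row    u w = onlyAt v u (edge S u w)
    column : ∑∑ at-column ≡ ∑[ u < N ] edge S u v
    column = sum-cong-≗ (λ u → ∑-onlyAt (edge S u) v)
    row : ∑∑ at-row ≡ ∑[ w < N ] edge S v w
    row = trans (∑-comm at-row) (sum-cong-≗ (λ w → ∑-onlyAt (λ u → edge S u w) v))

  edgesIn-remove : ∀ S v → inS G S v ≡ true → edgesIn G (S [ v ]≔ false) + degIn G S v ≡ edgesIn G S
  edgesIn-remove S v v∈S = begin
    edgesIn G S′ + degIn G S v
      ≡⟨ cong₂ _+_ (edgesIn-∑ S′) (degIn-∑ S v) ⟩
    ∑∑ (edge S′) + ∑[ u < N ] 𝟙 (inS G S u ∧ adj G v u)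
      ≡⟨ cong (∑∑ (edge S′) +_) (sum-cong-≗ flip-at-v) ⟨
    ∑∑ (edge S′) + ∑[ u < N ] (edge S u v + edge S v u)
      ≡⟨ cong (∑∑ (edge S′) +_) (∑-distrib-+ (λ u → edge S u v) (edge S v)) ⟩
    ∑∑ (edge S′) + (∑[ u < N ] edge S u v + ∑[ u < N ] edge S v u)
      ≡⟨ ∑∑-edge-remove S v ⟨
    ∑∑ (edge S)
      ≡⟨ edgesIn-∑ S ⟨
    edgesIn G S ∎
    where
    open ≡-Reasoning
    S′ = S [ v ]≔ false
    flip-at-v : ∀ u → edge S u v + edge S v u ≡ 𝟙 (inS G S u ∧ adj G v u)
    flip-at-v u rewrite edge-+-flip S u v | v∈S | Graph.sym G u v = refl

  2*edgesIn≤n*n : ∀ S → 2 * edgesIn G S ≤ N * N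
  2*edgesIn≤n*n S = begin
    2 * edgesIn G S
      ≡⟨ cong (edgesIn G S +_) (+-identityʳ (edgesIn G S)) ⟩
    edgesIn G S + edgesIn G S
      ≡⟨ cong₂ _+_ (edgesIn-∑ S) (trans (edgesIn-∑ S) (∑-comm (edge S))) ⟩
    ∑∑ (edge S) + ∑∑ (λ u w → edge S w u)
      ≡⟨ ∑∑-distrib-+ (edge S) (λ u w → edge S w u) ⟨
    ∑∑ (λ u w → edge S u w + edge S w u)
      ≤⟨ ∑-mono-≤ (λ u → ∑-mono-≤ (edge-pair≤1 u)) ⟩
    ∑[ u < N ] ∑[ w < N ] 1
      ≡⟨ sum-cong-≗ {N} (λ _ → trans (∑-const N 1) (*-identityʳ N)) ⟩
    ∑[ u < N ] N
      ≡⟨ ∑-const N N ⟩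
    N * N ∎
    where
    open ≤-Reasoning
    edge-pair≤1 : ∀ u w → edge S u w + edge S w u ≤ 1
    edge-pair≤1 u w rewrite edge-+-flip S u w = 𝟙≤1 _

  maxDegIn-attained : ∀ S → maxDegIn G S ≡ 0 ⊎ ∃[ v ] inS G S v ≡ true × degIn G S v ≡ maxDegIn G S
  maxDegIn-attained S with foldr-selective ⊔-sel 0 (map degInS (allFin N))
    where
    degInS : Fin N → ℕ
    degInS v = if inS G S v then degIn G S v else 0
  ... | inj₁ Δ≡0 = inj₁ Δ≡0
  ... | inj₂ Δ∈ with ∈-map⁻ _ Δ∈
  ...   | v , _ , Δ≡deg with inS G S v in v∈S
  ...     | true  = inj₂ (v , v∈S , ≡.sym Δ≡deg)
  ...     | false = inj₁ Δ≡deg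

  edgesIn≡0⇒maxDegIn≡0 : ∀ S → edgesIn G S ≡ 0 → maxDegIn G S ≡ 0
  edgesIn≡0⇒maxDegIn≡0 S E≡0 with maxDegIn-attained S
  ... | inj₁ Δ≡0 = Δ≡0
  ... | inj₂ (v , v∈S , deg≡Δ) =
    trans (≡.sym deg≡Δ) (m+n≡0⇒n≡0 (edgesIn G (S [ v ]≔ false)) (trans (edgesIn-remove S v v∈S) E≡0))

  edgesIn-remove-maxDeg : ∀ S v k → inS G S v ≡ true → degIn G S v ≡ maxDegIn G S →
    k * (2 * edgesIn G S) < maxDegIn G S * ∣ S ∣ →
    ∣ S ∣ * edgesIn G (S [ v ]≔ false) ≤ edgesIn G S * (∣ S ∣ ∸ 2 * k)
  edgesIn-remove-maxDeg S v k v∈S deg≡Δ = n*e′≤e*[n∸2k] {∣ S ∣} {d = maxDegIn G S} {k}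
    (trans (cong (edgesIn G (S [ v ]≔ false) +_) (≡.sym deg≡Δ)) (edgesIn-remove S v v∈S))

-- Greedy deletion

shrunkProduct : (ℕ → ℕ) → ℕ → ℕ → ℕ
shrunkProduct κ m zero    = 1
shrunkProduct κ m (suc j) = (m + suc j ∸ 2 * κ (m + suc j)) * shrunkProduct κ m j

rangeProduct : ℕ → ℕ → ℕ
rangeProduct m zero    = 1
rangeProduct m (suc j) = (m + suc j) * rangeProduct m j

Admissible : (ℕ → ℕ) → ℕ → ℕ → Set
Admissible κ m j = ∀ {i} → i < j → 3 ^ κ (m + suc i) ≤ m + suc i

LogBounded : ∀ {N} → Graph N → Subset N → Set
LogBounded G S = ExpLe (maxDegIn G S * ∣ S ∣) (∣ S ∣ ^ (2 * edgesIn G S))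

InitialBound : (ℕ → ℕ) → ℕ → ℕ → Set
InitialBound κ m j = (m + j) * (m + j) * shrunkProduct κ m j < 2 * rangeProduct m j

Schedule : ℕ → ℕ → Set
Schedule m j = ∃[ κ ] Admissible κ m j × InitialBound κ m j

module _ {N : ℕ} (G : Graph N) where

  greedy : ∀ κ m j → Admissible κ m j → ∀ S → ∣ S ∣ ≡ m + j →
           edgesIn G S * shrunkProduct κ m j < rangeProduct m j →
           ∃[ T ] m ≤ ∣ T ∣ × LogBounded G T
  greedy κ m zero _ S |S|≡m E<1 = S , ≤-reflexive (≡.sym (trans |S|≡m (+-identityʳ m))) , logBounded
    where
    E≡0 : edgesIn G S ≡ 0
    E≡0 = n<1⇒n≡0 (subst (_< 1) (*-identityʳ _) E<1)
    logBounded : LogBounded G S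
    logBounded rewrite E≡0 | edgesIn≡0⇒maxDegIn≡0 G S E≡0 = ExpLe-3^ 0
  greedy κ m (suc j) adm S |S|≡n E·U<V with maxDegIn G S * ∣ S ∣ ≤? κ (m + suc j) * (2 * edgesIn G S)
  ... | yes Δ|S|≤2kE = S , m≤|S| , ExpLe-^ {k = κ (m + suc j)} 3ᵏ≤|S| Δ|S|≤2kE
    where
    m≤|S| : m ≤ ∣ S ∣
    m≤|S| = subst (m ≤_) (≡.sym |S|≡n) (m≤m+n m (suc j))
    3ᵏ≤|S| : 3 ^ κ (m + suc j) ≤ ∣ S ∣
    3ᵏ≤|S| = subst (3 ^ κ (m + suc j) ≤_) (≡.sym |S|≡n) (adm ≤-refl)
  ... | no Δ|S|≰2kE with maxDegIn-attained G S
  ...   | inj₁ Δ≡0 =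
    ⊥-elim (Δ|S|≰2kE (subst (λ Δ → Δ * ∣ S ∣ ≤ κ (m + suc j) * (2 * edgesIn G S)) (≡.sym Δ≡0) z≤n))
  ...   | inj₂ (v , v∈S , deg≡Δ) =
    greedy κ m j (adm ∘ m≤n⇒m≤1+n) (S [ v ]≔ false) |S′|≡m+j E′·U<V
    where
    n = m + suc j
    U = shrunkProduct κ m j
    |S′|≡m+j : ∣ S [ v ]≔ false ∣ ≡ m + j
    |S′|≡m+j = suc-injective (trans (∣p[x]≔false∣ S v v∈S) (trans |S|≡n (+-suc m j)))
    n·E′≤E·[n∸2k] : n * edgesIn G (S [ v ]≔ false) ≤ edgesIn G S * (n ∸ 2 * κ n)
    n·E′≤E·[n∸2k] =
      subst (λ x → x * edgesIn G (S [ v ]≔ false) ≤ edgesIn G S * (x ∸ 2 * κ n)) |S|≡n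
        (edgesIn-remove-maxDeg G S v (κ n) v∈S deg≡Δ (≰⇒> Δ|S|≰2kE))
    E′·U<V : edgesIn G (S [ v ]≔ false) * U < rangeProduct m j
    E′·U<V = *-cancelˡ-< n _ _ (begin-strict
      n * (edgesIn G (S [ v ]≔ false) * U)   ≡⟨ *-assoc n _ U ⟨
      n * edgesIn G (S [ v ]≔ false) * U     ≤⟨ *-monoˡ-≤ U n·E′≤E·[n∸2k] ⟩
      edgesIn G S * (n ∸ 2 * κ n) * U        ≡⟨ *-assoc (edgesIn G S) _ U ⟩
      edgesIn G S * shrunkProduct κ m (suc j) <⟨ E·U<V ⟩
      rangeProduct m (suc j)                  ∎)
      where open ≤-Reasoning

  greedy-from-⊤ : ∀ {m j} → m + j ≡ N → Schedule m j → ∃[ T ] m ≤ ∣ T ∣ × LogBounded G T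
  greedy-from-⊤ {m} {j} m+j≡N (κ , admissible , n²U<2V) = greedy κ m j admissible ⊤ |⊤|≡m+j E·U<V
    where
    |⊤|≡m+j : ∣ ⊤ {N} ∣ ≡ m + j
    |⊤|≡m+j = trans (∣⊤∣≡n N) (≡.sym m+j≡N)
    2E≤n² : 2 * edgesIn G ⊤ ≤ (m + j) * (m + j)
    2E≤n² = subst (λ n → 2 * edgesIn G ⊤ ≤ n * n) (≡.sym m+j≡N) (2*edgesIn≤n*n G ⊤)
    E·U<V : edgesIn G ⊤ * shrunkProduct κ m j < rangeProduct m j
    E·U<V = *-cancelˡ-< 2 _ _ (begin-strict
      2 * (edgesIn G ⊤ * shrunkProduct κ m j) ≡⟨ *-assoc 2 (edgesIn G ⊤) _ ⟨
      2 * edgesIn G ⊤ * shrunkProduct κ m j   ≤⟨ *-monoˡ-≤ (shrunkProduct κ m j) 2E≤n² ⟩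
      (m + j) * (m + j) * shrunkProduct κ m j <⟨ n²U<2V ⟩
      2 * rangeProduct m j                    ∎)
      where open ≤-Reasoning

-- The initial invariant

⌈_/6⌉ : ℕ → ℕ
⌈ N /6⌉ = (N + 5) / 6

N≤6*⌈N/6⌉ : ∀ N → N ≤ 6 * ⌈ N /6⌉
N≤6*⌈N/6⌉ N = +-cancelʳ-≤ 5 N (6 * ⌈ N /6⌉) (begin
  N + 5                          ≡⟨ m≡m%n+[m/n]*n (N + 5) 6 ⟩
  (N + 5) % 6 + ⌈ N /6⌉ * 6      ≤⟨ +-monoˡ-≤ (⌈ N /6⌉ * 6) (s≤s⁻¹ (m%n<n (N + 5) 6)) ⟩
  5 + ⌈ N /6⌉ * 6                ≡⟨ +-comm 5 _ ⟩
  ⌈ N /6⌉ * 6 + 5                ≡⟨ cong (_+ 5) (*-comm ⌈ N /6⌉ 6) ⟩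
  6 * ⌈ N /6⌉ + 5                ∎)
  where open ≤-Reasoning

6*⌈N/6⌉≤N+5 : ∀ N → 6 * ⌈ N /6⌉ ≤ N + 5
6*⌈N/6⌉≤N+5 N = subst (_≤ N + 5) (*-comm ⌈ N /6⌉ 6) (m/n*n≤m (N + 5) 6)

⌈N/6⌉≤N : ∀ N → 1 ≤ N → ⌈ N /6⌉ ≤ N
⌈N/6⌉≤N N 1≤N = *-cancelˡ-≤ 6 (begin
  6 * ⌈ N /6⌉ ≤⟨ 6*⌈N/6⌉≤N+5 N ⟩
  N + 5       ≤⟨ +-monoʳ-≤ N (*-monoʳ-≤ 5 1≤N) ⟩
  6 * N       ∎)
  where open ≤-Reasoning

κ-small : ℕ → ℕ
κ-small n = if n <ᵇ 9 then 1 else if n <ᵇ 27 then 2 else if n <ᵇ 81 then 3 else 4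

3^κ-small≤ : ∀ n → 3 ≤ n → 3 ^ κ-small n ≤ n
3^κ-small≤ n 3≤n with n <ᵇ 9 | <ᵇ-reflects-< n 9
... | true  | _        = 3≤n
... | false | ofⁿ n≮9 with n <ᵇ 27 | <ᵇ-reflects-< n 27
...   | true  | _         = ≮⇒≥ n≮9
...   | false | ofⁿ n≮27 with n <ᵇ 81 | <ᵇ-reflects-< n 81
...     | true  | _         = ≮⇒≥ n≮27
...     | false | ofⁿ n≮81  = ≮⇒≥ n≮81

small-bounds : ∀ (i : Fin 468) →
  InitialBound κ-small ⌈ 12 + toℕ i /6⌉ (12 + toℕ i ∸ ⌈ 12 + toℕ i /6⌉)
small-bounds = toWitness {a? = Fin.all? (λ i → _ <? _)} _

small-schedule : ∀ N → 12 ≤ N → N < 480 → Schedule ⌈ N /6⌉ (N ∸ ⌈ N /6⌉)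
small-schedule N 12≤N N<480 = κ-small , admissible , bound
  where
  m = ⌈ N /6⌉
  2≤m : 2 ≤ m
  2≤m = *-cancelˡ-≤ 6 (≤-trans 12≤N (N≤6*⌈N/6⌉ N))
  admissible : Admissible κ-small m (N ∸ m)
  admissible {i} _ = 3^κ-small≤ (m + suc i) (+-mono-≤ 2≤m (s≤s z≤n))
  N∸12<468 : N ∸ 12 < 468
  N∸12<468 = ∸-monoˡ-< N<480 12≤N
  12+[N∸12]≡N : 12 + toℕ (fromℕ< N∸12<468) ≡ N
  12+[N∸12]≡N = trans (cong (12 +_) (Fin.toℕ-fromℕ< N∸12<468)) (m+[n∸m]≡n 12≤N)
  bound : InitialBound κ-small m (N ∸ m)
  bound = subst (λ n → InitialBound κ-small ⌈ n /6⌉ (n ∸ ⌈ n /6⌉)) 12+[N∸12]≡N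
                (small-bounds (fromℕ< N∸12<468))

P′-suc : ∀ x t → (suc x P′ t) * (suc x ∸ t) ≡ suc x * (x P′ t)
P′-suc x zero    = *-comm 1 (suc x)
P′-suc x (suc t) = begin
  (suc x ∸ t) * (suc x P′ t) * (x ∸ t)   ≡⟨ cong (_* (x ∸ t)) (*-comm (suc x ∸ t) (suc x P′ t)) ⟩
  (suc x P′ t) * (suc x ∸ t) * (x ∸ t)   ≡⟨ cong (_* (x ∸ t)) (P′-suc x t) ⟩
  suc x * (x P′ t) * (x ∸ t)             ≡⟨ xy∙z≈x∙zy (suc x) (x P′ t) (x ∸ t) ⟩
  suc x * ((x ∸ t) * (x P′ t))           ∎
  where open ≡-Reasoning

P′-pos : ∀ {x t} → t ≤ x → 0 < (x P′ t)
P′-pos {x} {zero}  _   = s≤s z≤n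
P′-pos {x} {suc t} t<x = *-mono-< (m<n⇒0<n∸m t<x) (P′-pos (<⇒≤ t<x))

P′-ratio : ∀ {a b x y} t → b ≤ a → a * x ≤ b * y → a ^ t * (x P′ t) ≤ b ^ t * (y P′ t)
P′-ratio zero    b≤a ax≤by = ≤-refl
P′-ratio {a} {b} {x} {y} (suc t) b≤a ax≤by = begin
  a * a ^ t * ((x ∸ t) * (x P′ t))     ≡⟨ interchange a (a ^ t) (x ∸ t) (x P′ t) ⟩
  a * (x ∸ t) * (a ^ t * (x P′ t))     ≤⟨ *-mono-≤ a[x∸t]≤b[y∸t] (P′-ratio t b≤a ax≤by) ⟩
  b * (y ∸ t) * (b ^ t * (y P′ t))     ≡⟨ interchange b (y ∸ t) (b ^ t) (y P′ t) ⟩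
  b * b ^ t * ((y ∸ t) * (y P′ t))     ∎
  where
  open ≤-Reasoning
  a[x∸t]≤b[y∸t] : a * (x ∸ t) ≤ b * (y ∸ t)
  a[x∸t]≤b[y∸t] = begin
    a * (x ∸ t)     ≡⟨ *-distribˡ-∸ a x t ⟩
    a * x ∸ a * t   ≤⟨ ∸-mono ax≤by (*-monoˡ-≤ t b≤a) ⟩
    b * y ∸ b * t   ≡⟨ *-distribˡ-∸ b y t ⟨
    b * (y ∸ t)     ∎

shrunkProduct-telescopes : ∀ K m j →
  shrunkProduct (λ _ → K) m j * ((m + j) P′ (2 * K)) ≡ rangeProduct m j * (m P′ (2 * K))
shrunkProduct-telescopes K m zero    = cong (λ n → 1 * (n P′ (2 * K))) (+-identityʳ m)
shrunkProduct-telescopes K m (suc j) = begin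
  (m + suc j ∸ 2 * K) * U * F (m + suc j)      ≡⟨ xy∙z≈y∙zx (m + suc j ∸ 2 * K) U _ ⟩
  U * (F (m + suc j) * (m + suc j ∸ 2 * K))    ≡⟨ cong (λ n → U * (F n * (n ∸ 2 * K))) (+-suc m j) ⟩
  U * (F (suc (m + j)) * (suc (m + j) ∸ 2 * K)) ≡⟨ cong (U *_) (P′-suc (m + j) (2 * K)) ⟩
  U * (suc (m + j) * F (m + j))                ≡⟨ x∙yz≈y∙xz U (suc (m + j)) _ ⟩
  suc (m + j) * (U * F (m + j))                ≡⟨ cong (suc (m + j) *_) (shrunkProduct-telescopes K m j) ⟩
  suc (m + j) * (V * F m)                      ≡⟨ cong (_* (V * F m)) (+-suc m j) ⟨
  (m + suc j) * (V * F m)                      ≡⟨ *-assoc (m + suc j) V (F m) ⟨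
  (m + suc j) * V * F m                        ∎
  where
  open ≡-Reasoning
  U = shrunkProduct (λ _ → K) m j
  V = rangeProduct m j
  F : ℕ → ℕ
  F n = n P′ (2 * K)

rangeProduct-pos : ∀ m j → 0 < rangeProduct m j
rangeProduct-pos m zero    = s≤s z≤n
rangeProduct-pos m (suc j) = *-mono-< (<-≤-trans (s≤s z≤n) (m≤n+m (suc j) m)) (rangeProduct-pos m j)

InitialBound-const : ∀ K m j → (m + j) * (m + j) * (m P′ (2 * K)) < 2 * ((m + j) P′ (2 * K)) →
                     InitialBound (λ _ → K) m j
InitialBound-const K m j n²Fₘ<2Fₙ = *-cancelʳ-< Fₙ (n * n * U) (2 * V) (begin-strict
  n * n * U * Fₙ     ≡⟨ *-assoc (n * n) U Fₙ ⟩
  n * n * (U * Fₙ)   ≡⟨ cong (n * n *_) (shrunkProduct-telescopes K m j) ⟩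
  n * n * (V * Fₘ)   ≡⟨ x∙yz≈y∙xz (n * n) V Fₘ ⟩
  V * (n * n * Fₘ)   <⟨ *-monoʳ-< V {{>-nonZero (rangeProduct-pos m j)}} n²Fₘ<2Fₙ ⟩
  V * (2 * Fₙ)       ≡⟨ *-assoc V 2 Fₙ ⟨
  V * 2 * Fₙ         ≡⟨ cong (_* Fₙ) (*-comm V 2) ⟩
  2 * V * Fₙ         ∎)
  where
  open ≤-Reasoning
  n  = m + j
  U  = shrunkProduct (λ _ → K) m j
  V  = rangeProduct m j
  Fₙ = n P′ (2 * K)
  Fₘ = m P′ (2 * K)

scaled-^-mono : ∀ {a b c d} k → a ≤ b → c * a ^ k ≤ d * b ^ k →
                ∀ j → c * a ^ (j + k) ≤ d * b ^ (j + k)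
scaled-^-mono k a≤b base zero = base
scaled-^-mono {a} {b} {c} {d} k a≤b base (suc j) = begin
  c * (a * a ^ (j + k)) ≡⟨ x∙yz≈y∙xz c a _ ⟩
  a * (c * a ^ (j + k)) ≤⟨ *-mono-≤ a≤b (scaled-^-mono {a} {b} {c} {d} k a≤b base j) ⟩
  b * (d * b ^ (j + k)) ≡⟨ x∙yz≈y∙xz b d _ ⟩
  d * (b * b ^ (j + k)) ∎
  where open ≤-Reasoning

N²10²ᴷ<2·59²ᴷ : ∀ {N K} → 4 ≤ K → N < 18 * 3 ^ K → N * N * 10 ^ (2 * K) < 2 * 59 ^ (2 * K)
N²10²ᴷ<2·59²ᴷ {N} {K} 4≤K N<18·3ᴷ = begin-strict
  N * N * 10 ^ (2 * K)
    <⟨ *-monoˡ-< (10 ^ (2 * K)) {{m^n≢0 10 (2 * K)}} (*-mono-< N<18·3ᴷ N<18·3ᴷ) ⟩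
  18 * 3 ^ K * (18 * 3 ^ K) * 10 ^ (2 * K)
    ≡⟨ regroup (3 ^ K) (10 ^ (2 * K)) ⟩
  324 * (3 ^ K * 3 ^ K * 10 ^ (2 * K))
    ≡⟨ cong (λ z → 324 * (z * 10 ^ (2 * K))) (^-distribʳ-* 3 3 K) ⟨
  324 * (9 ^ K * 10 ^ (2 * K))
    ≡⟨ cong (λ z → 324 * (9 ^ K * z)) (^-*-assoc 10 2 K) ⟨
  324 * (9 ^ K * 100 ^ K)
    ≡⟨ cong (324 *_) (^-distribʳ-* 9 100 K) ⟨
  324 * 900 ^ K
    ≤⟨ subst (λ k → 324 * 900 ^ k ≤ 2 * 3481 ^ k) (m∸n+n≡m 4≤K)
             (scaled-^-mono {900} {3481} {324} {2} 4 (m≤m+n 900 2581) base (K ∸ 4)) ⟩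
  2 * 3481 ^ K
    ≡⟨ cong (2 *_) (^-*-assoc 59 2 K) ⟩
  2 * 59 ^ (2 * K)
    ∎
  where
  open ≤-Reasoning
  regroup : ∀ x y → 18 * x * (18 * x) * y ≡ 324 * (x * x * y)
  regroup = solve-∀
  base : 324 * 900 ^ 4 ≤ 2 * 3481 ^ 4
  base = ≤ᵇ⇒≤ (324 * 900 ^ 4) (2 * 3481 ^ 4) tt

N²Fₘ<2Fₙ : ∀ {N m K} → 59 * m ≤ 10 * N → 2 * K ≤ N → N * N * 10 ^ (2 * K) < 2 * 59 ^ (2 * K) →
           N * N * (m P′ (2 * K)) < 2 * (N P′ (2 * K))
N²Fₘ<2Fₙ {N} {m} {K} 59m≤10N 2K≤N N²10²ᴷ<2·59²ᴷ = *-cancelʳ-< (59 ^ (2 * K)) _ _ (begin-strict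
  N * N * Fₘ * 59 ^ (2 * K)      ≡⟨ xy∙z≈x∙zy (N * N) Fₘ (59 ^ (2 * K)) ⟩
  N * N * (59 ^ (2 * K) * Fₘ)    ≤⟨ *-monoʳ-≤ (N * N) (P′-ratio (2 * K) (m≤m+n 10 49) 59m≤10N) ⟩
  N * N * (10 ^ (2 * K) * Fₙ)    ≡⟨ *-assoc (N * N) (10 ^ (2 * K)) Fₙ ⟨
  N * N * 10 ^ (2 * K) * Fₙ      <⟨ *-monoˡ-< Fₙ {{>-nonZero (P′-pos 2K≤N)}} N²10²ᴷ<2·59²ᴷ ⟩
  2 * 59 ^ (2 * K) * Fₙ          ≡⟨ xy∙z≈xz∙y 2 (59 ^ (2 * K)) Fₙ ⟩
  2 * Fₙ * 59 ^ (2 * K)          ∎)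
  where
  open ≤-Reasoning
  Fₙ = N P′ (2 * K)
  Fₘ = m P′ (2 * K)

⌊log⌋-exists : ∀ b → 1 < b → ∀ x → 0 < x → ∃[ k ] b ^ k ≤ x × x < b ^ suc k
⌊log⌋-exists b 1<b (suc zero)    _ = 0 , ≤-refl , subst (1 <_) (≡.sym (*-identityʳ b)) 1<b
⌊log⌋-exists b 1<b (suc (suc x)) _ with ⌊log⌋-exists b 1<b (suc x) (s≤s z≤n)
... | k , bᵏ≤1+x , 1+x<bᵏ⁺¹ with suc (suc x) <? b ^ suc k
...   | yes 2+x<bᵏ⁺¹ = k , m≤n⇒m≤1+n bᵏ≤1+x , 2+x<bᵏ⁺¹
...   | no  2+x≮bᵏ⁺¹ =
  suc k , ≮⇒≥ 2+x≮bᵏ⁺¹ , ≤-<-trans 1+x<bᵏ⁺¹ (^-monoʳ-< b 1<b (n<1+n (suc k)))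

2k<3ᵏ : ∀ k → 2 * k < 3 ^ k
2k<3ᵏ zero    = s≤s z≤n
2k<3ᵏ (suc k) = begin-strict
  2 * suc k         ≡⟨ *-suc 2 k ⟩
  2 + 2 * k         <⟨ +-monoʳ-< 2 (2k<3ᵏ k) ⟩
  2 + 3 ^ k         ≤⟨ +-monoˡ-≤ (3 ^ k) (*-monoʳ-≤ 2 (m^n>0 3 k)) ⟩
  2 * 3 ^ k + 3 ^ k ≡⟨ +-comm (2 * 3 ^ k) (3 ^ k) ⟩
  3 * 3 ^ k         ∎
  where open ≤-Reasoning

-- With K = ⌊log₃ (m + 1)⌋ we need N² · m P′ 2K < 2 · N P′ 2K. As m/N ≤ 10/59 and N < 18 · 3 ^ K,
-- the left side is below 324 · (900/3481) ^ K · N P′ 2K, and 324 · (900/3481) ^ K ≤ 2 once K ≥ 4,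
-- which holds because m ≥ 80.
large-schedule : ∀ N → 480 ≤ N → Schedule ⌈ N /6⌉ (N ∸ ⌈ N /6⌉)
large-schedule N 480≤N with ⌊log⌋-exists 3 (s≤s (s≤s z≤n)) (suc ⌈ N /6⌉) (s≤s z≤n)
... | K , 3ᴷ≤1+m , 1+m<3ᴷ⁺¹ = (λ _ → K) , admissible , InitialBound-const K m j n²Fₘ<2Fₙ
  where
  m = ⌈ N /6⌉
  j = N ∸ m
  m≤N : m ≤ N
  m≤N = ⌈N/6⌉≤N N (≤-trans (s≤s z≤n) 480≤N)
  m+j≡N : m + j ≡ N
  m+j≡N = m+[n∸m]≡n m≤N
  80≤m : 80 ≤ m
  80≤m = *-cancelˡ-≤ 6 (≤-trans 480≤N (N≤6*⌈N/6⌉ N))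
  admissible : Admissible (λ _ → K) m j
  admissible {i} _ = ≤-trans 3ᴷ≤1+m (≤-trans (s≤s (m≤m+n m i)) (≤-reflexive (≡.sym (+-suc m i))))
  4≤K : 4 ≤ K
  4≤K = ≮⇒≥ (λ K<4 → <⇒≱ (s≤s⁻¹ (<-≤-trans 1+m<3ᴷ⁺¹ (^-monoʳ-≤ 3 K<4))) 80≤m)
  2K≤N : 2 * K ≤ N
  2K≤N = ≤-trans (s≤s⁻¹ (<-≤-trans (2k<3ᵏ K) 3ᴷ≤1+m)) m≤N
  N<18·3ᴷ : N < 18 * 3 ^ K
  N<18·3ᴷ = ≤-<-trans (N≤6*⌈N/6⌉ N)
    (subst (6 * m <_) (≡.sym (*-assoc 6 3 (3 ^ K))) (*-monoʳ-< 6 (<-trans (n<1+n m) 1+m<3ᴷ⁺¹)))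
  59m≤10N : 59 * m ≤ 10 * N
  59m≤10N = +-cancelʳ-≤ m (59 * m) (10 * N) (begin
    59 * m + m   ≡⟨ identity m ⟩
    10 * (6 * m) ≤⟨ *-monoʳ-≤ 10 (6*⌈N/6⌉≤N+5 N) ⟩
    10 * (N + 5) ≡⟨ *-distribˡ-+ 10 N 5 ⟩
    10 * N + 50  ≤⟨ +-monoʳ-≤ (10 * N) (≤-trans (m≤m+n 50 30) 80≤m) ⟩
    10 * N + m   ∎)
    where
    open ≤-Reasoning
    identity : ∀ m → 59 * m + m ≡ 10 * (6 * m)
    identity = solve-∀
  n²Fₘ<2Fₙ : (m + j) * (m + j) * (m P′ (2 * K)) < 2 * ((m + j) P′ (2 * K))
  n²Fₘ<2Fₙ = subst (λ n → n * n * (m P′ (2 * K)) < 2 * (n P′ (2 * K))) (≡.sym m+j≡N)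
    (N²Fₘ<2Fₙ {N} {m} {K} 59m≤10N 2K≤N (N²10²ᴷ<2·59²ᴷ {N} {K} 4≤K N<18·3ᴷ))

schedule : ∀ N → 12 ≤ N → Schedule ⌈ N /6⌉ (N ∸ ⌈ N /6⌉)
schedule N 12≤N with N <? 480
... | yes N<480 = small-schedule N 12≤N N<480
... | no  N≮480 = large-schedule N (≮⇒≥ N≮480)

lemma2p2 : (N : ℕ) → 12 ≤ N → (G : Graph N) →
    Σ (Subset N) (λ S →
      (N ≤ 6 * ∣ S ∣) ×
      ExpLe (maxDegIn G S * ∣ S ∣) (∣ S ∣ ^ (2 * edgesIn G S)))
lemma2p2 N 12≤N G with greedy-from-⊤ G m+j≡N (schedule N 12≤N)
  where
  m+j≡N : ⌈ N /6⌉ + (N ∸ ⌈ N /6⌉) ≡ N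
  m+j≡N = m+[n∸m]≡n (⌈N/6⌉≤N N (≤-trans (s≤s z≤n) 12≤N))
... | T , ⌈N/6⌉≤|T| , logBounded = T , ≤-trans (N≤6*⌈N/6⌉ N) (*-monoʳ-≤ 6 ⌈N/6⌉≤|T|) , logBounded
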